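{- For every nonnegative integer $n$ and every set $A$ of nimbers and special moons with $*n\in A$, the special moon $\mathrm{SMoon}(n)_A\cong\{\{\infty\mid *n\},A\mid A,\{*n\mid\overline\infty\}\}$ satisfies $\mathrm{SMoon}(n)_A=_{\widetilde{\mathrm{Im}}^\infty}\mathrm{Moon}$, where $\mathrm{Moon}\cong\{\infty\mid\overline\infty\}$.
   Context: Games. Two players, Left and Right, alternate; a position $G$ is determined by its set $G^{\mathcal L}$ of Left options and $G^{\mathcal R}$ of Right options, written $G\cong\{G^{\mathcal L}\mid G^{\mathcal R}\}$. The disjunctive sum is $G+H\cong\{G^{\mathcal L}+H,\,G+H^{\mathcal L}\mid G^{\mathcal R}+H,\,G+H^{\mathcal R}\}$ (each move is made in exactly one component). Normal play: a player with no move loses. The outcome $o(G)$ is $\mathcal N$ if the player to move can force a win, $\mathcal P$ if the other player can, $\mathcal L$ (resp. $\mathcal R$) if Left (resp. Right) can force a win whoever starts, and $\mathcal D$ if under optimal play neither player can force a win. Nimbers: $*0=0\cong\{\,\mid\,\}$ and $*n\cong\{*0,\dots,*(n-1)\mid *0,\dots,*(n-1)\}$. Impartial entailing games. Positions (short: every play is finite) are built recursively from two special positions $\infty$ and $\overline\infty$, which are immediate wins for Left and Right respectively: $o(\infty)=\mathcal L$, $o(\overline\infty)=\mathcal R$, $\infty+X=\infty$ for $X\neq\overline\infty$, $\overline\infty+X=\overline\infty$ for $X\neq\infty$ (so a Left option $\{\infty\mid G'\}$ forces Right to answer by moving to $G'$, modelling a carry-on move). Conjugate: $\infty$ and $\overline\infty$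 are conjugate to each other, and otherwise $\overline G=\{\overline{G^{\mathcal R}}\mid\overline{G^{\mathcal L}}\}$. $G$ is symmetric if $G\notin\{\infty,\overline\infty\}$ and $G^{\mathcal R}=\overline{G^{\mathcal L}}$; $G$ is quiet if $G\notin\{\infty,\overline\infty\}$, $\infty\notin G^{\mathcal L}$ and $\overline\infty\notin G^{\mathcal R}$. $\widetilde{\mathrm{Im}}^\infty$ is the set of symmetric positions all of whose quiet followers are symmetric, and $G=_{\widetilde{\mathrm{Im}}^\infty}H$ means $o(G+X)=o(H+X)$ for all $X\in\widetilde{\mathrm{Im}}^\infty$. The moon is $\mathrm{Moon}\cong\{\infty\mid\overline\infty\}$ (the paper uses a special symbol). A special moon (special symbol in the paper) is $\mathrm{SMoon}(n)_A\cong\{\{\infty\mid *n\},A\mid A,\{*n\mid\overline\infty\}\}$ with $A$ a set of nimbers and previously constructed special moons containing $*n$. -}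

module Defs where

open import Data.Nat using (ℕ; zero; suc)
open import Data.List using (List; []; _∷_; _++_; [_])
open import Data.List.Relation.Unary.All using (All)
open import Data.List.Relation.Unary.Any using (Any)
open import Data.Product using (Σ; _×_; ∃)
open import Data.Sum using (_⊎_)
open import Data.Bool using (Bool; true; false; not; _∨_)
open import Relation.Binary.PropositionalEquality using (_≡_)
open import Relation.Nullary using (¬_)

-- Short impartial entailing games (finite trees; option sets are
-- represented by finite lists, interpreted as sets via _≅_ below).

data Game : Set where
  ∞    : Game
  ∞̄    : Game
  node : (lefts rights : List Game) → Game

mutual
  data _≅_ : Game → Game → Set where
    ∞≅    : ∞ ≅ ∞
    ∞̄≅    : ∞̄ ≅ ∞̄
    node≅ : ∀ {ls rs ls' rs'} → SetEq ls ls' → SetEq rs rs' →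
            node ls rs ≅ node ls' rs'

  data SetEq (xs ys : List Game) : Set where
    seteq : All (λ x → Any (x ≅_) ys) xs → All (λ y → Any (_≅ y) xs) ys →
            SetEq xs ys

-- Disjunctive sum, with absorption by the infinities.
-- ∞ + X = X + ∞ = ∞ for X ≠ ∞̄ and ∞̄ + X = X + ∞̄ = ∞̄ for X ≠ ∞.
-- (The sums ∞ + ∞̄ and ∞̄ + ∞ never arise in the statement; they are
-- given the arbitrary values ∞ and ∞̄ respectively.)

mutual
  _+_ : Game → Game → Game
  ∞ + _ = ∞
  ∞̄ + _ = ∞̄
  node ls rs + ∞ = ∞
  node ls rs + ∞̄ = ∞̄
  node ls rs + node ls' rs' =
    node (addL ls (node ls' rs') ++ addR (node ls rs) ls')
         (addL rs (node ls' rs') ++ addR (node ls rs) rs')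

  addL : List Game → Game → List Game
  addL [] H = []
  addL (g ∷ gs) H = (g + H) ∷ addL gs H

  addR : Game → List Game → List Game
  addR G [] = []
  addR G (h ∷ hs) = (G + h) ∷ addR G hs

mutual
  leftWinsFirst : Game → Bool
  leftWinsFirst ∞ = true
  leftWinsFirst ∞̄ = false
  leftWinsFirst (node ls rs) = someLeftWin ls

  rightWinsFirst : Game → Bool
  rightWinsFirst ∞ = false
  rightWinsFirst ∞̄ = true
  rightWinsFirst (node ls rs) = someRightWin rs

  someLeftWin : List Game → Bool
  someLeftWin [] = false
  someLeftWin (g ∷ gs) = not (rightWinsFirst g) ∨ someLeftWin gs

  someRightWin : List Game → Bool
  someRightWin [] = false
  someRightWin (g ∷ gs) = not (leftWinsFirst g) ∨ someRightWin gs

data Outcome : Set where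
  𝓛 𝓡 𝓝 𝓟 𝓓 : Outcome

-- (Short games are determined, so 𝓓 never occurs as a value.)
outcome′ : Bool → Bool → Outcome
outcome′ true  true  = 𝓝
outcome′ true  false = 𝓛
outcome′ false true  = 𝓡
outcome′ false false = 𝓟

o : Game → Outcome
o G = outcome′ (leftWinsFirst G) (rightWinsFirst G)

mutual
  conj : Game → Game
  conj ∞ = ∞̄
  conj ∞̄ = ∞
  conj (node ls rs) = node (conjs rs) (conjs ls)

  conjs : List Game → List Game
  conjs [] = []
  conjs (g ∷ gs) = conj g ∷ conjs gs

data Symmetric : Game → Set where
  sym : ∀ {ls rs} → SetEq rs (conjs ls) → Symmetric (node ls rs)

data Quiet : Game → Set where
  quiet : ∀ {ls rs} → ¬ Any (_≡ ∞) ls → ¬ Any (_≡ ∞̄) rs → Quiet (node ls rs)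

data Follower (H : Game) : Game → Set where
  here   : Follower H H
  viaL   : ∀ {ls rs g} → Any (_≡ g) ls → Follower H g → Follower H (node ls rs)
  viaR   : ∀ {ls rs g} → Any (_≡ g) rs → Follower H g → Follower H (node ls rs)

InIm∞ : Game → Set
InIm∞ X = Symmetric X × (∀ H → Follower H X → Quiet H → Symmetric H)

_=Im∞_ : Game → Game → Set
G =Im∞ H = ∀ X → InIm∞ X → o (G + X) ≡ o (H + X)

mutual
  nim : ℕ → Game
  nim n = node (nimsBelow n) (nimsBelow n)

  nimsBelow : ℕ → List Game
  nimsBelow zero = []
  nimsBelow (suc n) = nimsBelow n ++ [ nim n ]

Moon : Game
Moon = node [ ∞ ] [ ∞̄ ]

SMoon : ℕ → List Game → Game
SMoon n A = node (node [ ∞ ] [ nim n ] ∷ A) (A ++ [ node [ nim n ] [ ∞̄ ] ])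

mutual
  data IsSMoon : Game → Set where
    mkSMoon : (n : ℕ) (A : List Game) → All NimOrSMoon A →
              Any (_≡ nim n) A → IsSMoon (SMoon n A)

  data NimOrSMoon (g : Game) : Set where
    isNim   : (k : ℕ) → g ≡ nim k → NimOrSMoon g
    isSMoon : IsSMoon g → NimOrSMoon g

-- Against a symmetric X, both Moon + X and SMoon(n)_A + X are first-player wins.
-- For Moon this is immediate. In SMoon(n)_A + X, if X has a Left option ∞ (equivalently,
-- by symmetry, a Right option ∞̄) the first player takes it. Otherwise, since *n and X are
-- self-conjugate, Left and Right have the same first-mover result b in *n + X. If b is false,
-- the mover plays SMoon(n)_A to *n ∈ A. If b is true, the mover plays the carry-on option
-- {∞ | *n} (resp. {*n | ∞̄}): every reply in X allows the immediate win ∞ (resp. ∞̄), so the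
-- opponent must answer with *n + X and then loses as second player there.
module Submission where

open import Defs
open import Data.Nat using (ℕ)
open import Data.Bool using (Bool; true; false; not; _∨_)
open import Data.Bool.Properties using (∨-zeroʳ; ∨-identityʳ; T-≡; ⇔→≡)
open import Data.Empty using (⊥-elim)
open import Data.List using (List; []; _∷_; _++_; [_]; map)
open import Data.Bool.ListAction using (any)
open import Data.List.Properties using (map-++)
open import Data.List.Membership.Propositional using (_∈_)
open import Data.List.Relation.Binary.BagAndSetEquality using (_∼[_]_; set; ∷-cong; ++-cong)
open import Data.List.Relation.Binary.Subset.Propositional using (_⊆_)
open import Data.List.Relation.Binary.Subset.Propositional.Properties using (Any-resp-⊆)
open import Data.List.Relation.Unary.All as All using (All; []; _∷_)
open import Data.List.Relation.Unary.Any as Any using (Any; here; there; any?)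
open import Data.List.Relation.Unary.Any.Properties using (any⁺; any⁻; ++⁺ˡ; ++⁺ʳ)
open import Data.Product using (_×_; _,_; proj₁; proj₂)
open import Function using (_∘_)
open import Function.Bundles using (Equivalence; mk⇔)
open import Function.Related.Propositional using (K-refl)
open import Relation.Binary.PropositionalEquality as ≡ using (_≡_; refl; cong; cong₂; subst)
open import Relation.Nullary using (¬_; Dec; yes; no)

open ≡.≡-Reasoning

wins : Game → Bool × Bool
wins G = leftWinsFirst G , rightWinsFirst G

o-𝓝 : ∀ G → leftWinsFirst G ≡ true → rightWinsFirst G ≡ true → o G ≡ 𝓝
o-𝓝 G lw rw rewrite lw | rw = refl

someLeftWin-intro : ∀ {g xs} → Any (_≡ g) xs → rightWinsFirst g ≡ false → someLeftWin xs ≡ true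
someLeftWin-intro (here refl) rw rewrite rw = refl
someLeftWin-intro {xs = x ∷ _} (there g∈xs) rw =
  ≡.trans (cong (not (rightWinsFirst x) ∨_) (someLeftWin-intro g∈xs rw)) (∨-zeroʳ _)

someRightWin-intro : ∀ {g xs} → Any (_≡ g) xs → leftWinsFirst g ≡ false → someRightWin xs ≡ true
someRightWin-intro (here refl) lw rewrite lw = refl
someRightWin-intro {xs = x ∷ _} (there g∈xs) lw =
  ≡.trans (cong (not (leftWinsFirst x) ∨_) (someRightWin-intro g∈xs lw)) (∨-zeroʳ _)

∈-addL : ∀ {g xs} H → Any (_≡ g) xs → Any (_≡ g + H) (addL xs H)
∈-addL H (here refl) = here refl
∈-addL H (there g∈xs) = there (∈-addL H g∈xs)

∈-addR : ∀ {h xs} G → Any (_≡ h) xs → Any (_≡ G + h) (addR G xs)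
∈-addR G (here refl) = here refl
∈-addR G (there h∈xs) = there (∈-addR G h∈xs)

leftWinsFirst-+ˡ : ∀ {g ls rs ls' rs'} → Any (_≡ g) ls → rightWinsFirst (g + node ls' rs') ≡ false →
                   leftWinsFirst (node ls rs + node ls' rs') ≡ true
leftWinsFirst-+ˡ {ls' = ls'} {rs'} g∈ls = someLeftWin-intro (++⁺ˡ (∈-addL (node ls' rs') g∈ls))

leftWinsFirst-+ʳ : ∀ {h ls rs ls' rs'} → Any (_≡ h) ls' → rightWinsFirst (node ls rs + h) ≡ false →
                   leftWinsFirst (node ls rs + node ls' rs') ≡ true
leftWinsFirst-+ʳ {ls = ls} {rs} {ls'} {rs'} h∈ls' =
  someLeftWin-intro (++⁺ʳ (addL ls (node ls' rs')) (∈-addR (node ls rs) h∈ls'))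

rightWinsFirst-+ˡ : ∀ {g ls rs ls' rs'} → Any (_≡ g) rs → leftWinsFirst (g + node ls' rs') ≡ false →
                    rightWinsFirst (node ls rs + node ls' rs') ≡ true
rightWinsFirst-+ˡ {ls' = ls'} {rs'} g∈rs = someRightWin-intro (++⁺ˡ (∈-addL (node ls' rs') g∈rs))

rightWinsFirst-+ʳ : ∀ {h ls rs ls' rs'} → Any (_≡ h) rs' → leftWinsFirst (node ls rs + h) ≡ false →
                    rightWinsFirst (node ls rs + node ls' rs') ≡ true
rightWinsFirst-+ʳ {ls = ls} {rs} {ls'} {rs'} h∈rs' =
  someRightWin-intro (++⁺ʳ (addL rs (node ls' rs')) (∈-addR (node ls rs) h∈rs'))

_≈ʷ_ : List Game → List Game → Set
xs ≈ʷ ys = map wins xs ∼[ set ] map wins ys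

any-cong-set : ∀ {A : Set} (p : A → Bool) {xs ys} → xs ∼[ set ] ys → any p xs ≡ any p ys
any-cong-set p xs≈ys = ⇔→≡ (mk⇔ (any-mono (Equivalence.to xs≈ys)) (any-mono (Equivalence.from xs≈ys)))
  where
  any-mono : ∀ {xs ys} → xs ⊆ ys → any p xs ≡ true → any p ys ≡ true
  any-mono xs⊆ys = Equivalence.to T-≡ ∘ any⁺ p ∘ Any-resp-⊆ xs⊆ys ∘ any⁻ p _ ∘ Equivalence.from T-≡

someLeftWin-wins : ∀ xs → someLeftWin xs ≡ any (not ∘ proj₂) (map wins xs)
someLeftWin-wins [] = refl
someLeftWin-wins (x ∷ xs) = cong (not (rightWinsFirst x) ∨_) (someLeftWin-wins xs)

someRightWin-wins : ∀ xs → someRightWin xs ≡ any (not ∘ proj₁) (map wins xs)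
someRightWin-wins [] = refl
someRightWin-wins (x ∷ xs) = cong (not (leftWinsFirst x) ∨_) (someRightWin-wins xs)

wins-node-cong : ∀ {ls rs ls' rs'} → ls ≈ʷ ls' → rs ≈ʷ rs' → wins (node ls rs) ≡ wins (node ls' rs')
wins-node-cong {ls} {rs} {ls'} {rs'} ls≈ls' rs≈rs' = cong₂ _,_
  (begin
    someLeftWin ls                         ≡⟨ someLeftWin-wins ls ⟩
    any (not ∘ proj₂) (map wins ls)        ≡⟨ any-cong-set (not ∘ proj₂) ls≈ls' ⟩
    any (not ∘ proj₂) (map wins ls')       ≡⟨ someLeftWin-wins ls' ⟨
    someLeftWin ls'                        ∎)
  (begin
    someRightWin rs                        ≡⟨ someRightWin-wins rs ⟩
    any (not ∘ proj₁) (map wins rs)        ≡⟨ any-cong-set (not ∘ proj₁) rs≈rs' ⟩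
    any (not ∘ proj₁) (map wins rs')       ≡⟨ someRightWin-wins rs' ⟨
    someRightWin rs'                       ∎)

++-congʷ : ∀ {xs xs' ys ys'} → xs ≈ʷ xs' → ys ≈ʷ ys' → (xs ++ ys) ≈ʷ (xs' ++ ys')
++-congʷ {xs} {xs'} {ys} {ys'} xs≈xs' ys≈ys'
  rewrite map-++ wins xs ys | map-++ wins xs' ys' = ++-cong xs≈xs' ys≈ys'

-- The recursion through SetEq is spelled out (rather than via All.map/Any.map) so that the
-- termination checker sees the calls on sub-derivations of ≅.
mutual
  wins-+-≅ : ∀ G {H H'} → H ≅ H' → wins (G + H) ≡ wins (G + H')
  wins-+-≅ ∞ _ = refl
  wins-+-≅ ∞̄ _ = refl
  wins-+-≅ (node _ _) ∞≅ = refl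
  wins-+-≅ (node _ _) ∞̄≅ = refl
  wins-+-≅ G@(node ls rs) H≅H'@(node≅ ls₁≈ls₂ rs₁≈rs₂) = wins-node-cong
    (++-congʷ (addL-congʷ ls H≅H') (addR-congʷ G ls₁≈ls₂))
    (++-congʷ (addL-congʷ rs H≅H') (addR-congʷ G rs₁≈rs₂))

  addL-congʷ : ∀ xs {H H'} → H ≅ H' → addL xs H ≈ʷ addL xs H'
  addL-congʷ [] _ = K-refl
  addL-congʷ (x ∷ xs) H≅H' = ∷-cong (wins-+-≅ x H≅H') (addL-congʷ xs H≅H')

  addR-congʷ : ∀ G {xs ys} → SetEq xs ys → addR G xs ≈ʷ addR G ys
  addR-congʷ G (seteq xs⊆ys ys⊆xs) = mk⇔ (addR-⊆ʷ G xs⊆ys) (addR-⊇ʷ G ys⊆xs)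

  addR-⊆ʷ : ∀ G {xs ys} → All (λ x → Any (x ≅_) ys) xs → map wins (addR G xs) ⊆ map wins (addR G ys)
  addR-⊆ʷ G (x∈ys ∷ _) (here refl) = wins-∈ʷ G x∈ys
  addR-⊆ʷ G (_ ∷ xs⊆ys) (there w∈) = addR-⊆ʷ G xs⊆ys w∈

  addR-⊇ʷ : ∀ G {xs ys} → All (λ y → Any (_≅ y) xs) ys → map wins (addR G ys) ⊆ map wins (addR G xs)
  addR-⊇ʷ G (y∈xs ∷ _) (here refl) = wins-∋ʷ G y∈xs
  addR-⊇ʷ G (_ ∷ ys⊆xs) (there w∈) = addR-⊇ʷ G ys⊆xs w∈

  wins-∈ʷ : ∀ G {x ys} → Any (x ≅_) ys → wins (G + x) ∈ map wins (addR G ys)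
  wins-∈ʷ G (here x≅y) = here (wins-+-≅ G x≅y)
  wins-∈ʷ G (there x∈ys) = there (wins-∈ʷ G x∈ys)

  wins-∋ʷ : ∀ G {y xs} → Any (_≅ y) xs → wins (G + y) ∈ map wins (addR G xs)
  wins-∋ʷ G (here x≅y) = here (≡.sym (wins-+-≅ G x≅y))
  wins-∋ʷ G (there y∈xs) = there (wins-∋ʷ G y∈xs)

mutual
  conj-involutive : ∀ g → conj (conj g) ≡ g
  conj-involutive ∞ = refl
  conj-involutive ∞̄ = refl
  conj-involutive (node ls rs) = cong₂ node (conjs-involutive ls) (conjs-involutive rs)

  conjs-involutive : ∀ xs → conjs (conjs xs) ≡ xs
  conjs-involutive [] = refl
  conjs-involutive (x ∷ xs) = cong₂ _∷_ (conj-involutive x) (conjs-involutive xs)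

conjs-++ : ∀ xs ys → conjs (xs ++ ys) ≡ conjs xs ++ conjs ys
conjs-++ [] ys = refl
conjs-++ (x ∷ xs) ys = cong (conj x ∷_) (conjs-++ xs ys)

mutual
  conj-distrib-+ : ∀ G H → conj (G + H) ≡ conj G + conj H
  conj-distrib-+ ∞ H = refl
  conj-distrib-+ ∞̄ H = refl
  conj-distrib-+ (node ls rs) ∞ = refl
  conj-distrib-+ (node ls rs) ∞̄ = refl
  conj-distrib-+ G@(node ls rs) H@(node ls' rs') = cong₂ node
    (≡.trans (conjs-++ (addL rs H) (addR G rs')) (cong₂ _++_ (conjs-addL rs H) (conjs-addR G rs')))
    (≡.trans (conjs-++ (addL ls H) (addR G ls')) (cong₂ _++_ (conjs-addL ls H) (conjs-addR G ls')))

  conjs-addL : ∀ xs H → conjs (addL xs H) ≡ addL (conjs xs) (conj H)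
  conjs-addL [] H = refl
  conjs-addL (x ∷ xs) H = cong₂ _∷_ (conj-distrib-+ x H) (conjs-addL xs H)

  conjs-addR : ∀ G xs → conjs (addR G xs) ≡ addR (conj G) (conjs xs)
  conjs-addR G [] = refl
  conjs-addR G (x ∷ xs) = cong₂ _∷_ (conj-distrib-+ G x) (conjs-addR G xs)

mutual
  leftWinsFirst-conj : ∀ g → leftWinsFirst (conj g) ≡ rightWinsFirst g
  leftWinsFirst-conj ∞ = refl
  leftWinsFirst-conj ∞̄ = refl
  leftWinsFirst-conj (node ls rs) = someLeftWin-conjs rs

  rightWinsFirst-conj : ∀ g → rightWinsFirst (conj g) ≡ leftWinsFirst g
  rightWinsFirst-conj ∞ = refl
  rightWinsFirst-conj ∞̄ = refl
  rightWinsFirst-conj (node ls rs) = someRightWin-conjs ls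

  someLeftWin-conjs : ∀ xs → someLeftWin (conjs xs) ≡ someRightWin xs
  someLeftWin-conjs [] = refl
  someLeftWin-conjs (x ∷ xs) = cong₂ (λ b c → not b ∨ c) (rightWinsFirst-conj x) (someLeftWin-conjs xs)

  someRightWin-conjs : ∀ xs → someRightWin (conjs xs) ≡ someLeftWin xs
  someRightWin-conjs [] = refl
  someRightWin-conjs (x ∷ xs) = cong₂ (λ b c → not b ∨ c) (leftWinsFirst-conj x) (someRightWin-conjs xs)

mutual
  conj-nim : ∀ n → conj (nim n) ≡ nim n
  conj-nim n = cong₂ node (conjs-nimsBelow n) (conjs-nimsBelow n)

  conjs-nimsBelow : ∀ n → conjs (nimsBelow n) ≡ nimsBelow n
  conjs-nimsBelow ℕ.zero = refl
  conjs-nimsBelow (ℕ.suc n) = ≡.trans (conjs-++ (nimsBelow n) [ nim n ])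
    (cong₂ _++_ (conjs-nimsBelow n) (cong [_] (conj-nim n)))

-- The sides are swapped so that one structural induction yields both symmetry of ≅ and
-- its compatibility with conjugation.
mutual
  conj-≅ : ∀ {G H} → G ≅ H → conj H ≅ conj G
  conj-≅ ∞≅ = ∞̄≅
  conj-≅ ∞̄≅ = ∞≅
  conj-≅ (node≅ ls≈ls' rs≈rs') = node≅ (conjs-SetEq rs≈rs') (conjs-SetEq ls≈ls')

  conjs-SetEq : ∀ {xs ys} → SetEq xs ys → SetEq (conjs ys) (conjs xs)
  conjs-SetEq (seteq xs⊆ys ys⊆xs) = seteq (conjs-⊇ ys⊆xs) (conjs-⊆ xs⊆ys)

  conjs-⊇ : ∀ {xs ys} → All (λ y → Any (_≅ y) xs) ys → All (λ u → Any (u ≅_) (conjs xs)) (conjs ys)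
  conjs-⊇ [] = []
  conjs-⊇ (y∈xs ∷ ys⊆xs) = conj-∈ y∈xs ∷ conjs-⊇ ys⊆xs

  conjs-⊆ : ∀ {xs ys} → All (λ x → Any (x ≅_) ys) xs → All (λ v → Any (_≅ v) (conjs ys)) (conjs xs)
  conjs-⊆ [] = []
  conjs-⊆ (x∈ys ∷ xs⊆ys) = conj-∋ x∈ys ∷ conjs-⊆ xs⊆ys

  conj-∈ : ∀ {y xs} → Any (_≅ y) xs → Any (conj y ≅_) (conjs xs)
  conj-∈ (here x≅y) = here (conj-≅ x≅y)
  conj-∈ (there y∈xs) = there (conj-∈ y∈xs)

  conj-∋ : ∀ {x ys} → Any (x ≅_) ys → Any (_≅ conj x) (conjs ys)
  conj-∋ (here x≅y) = here (conj-≅ x≅y)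
  conj-∋ (there x∈ys) = there (conj-∋ x∈ys)

symmetric⇒≅conj : ∀ {X} → Symmetric X → X ≅ conj X
symmetric⇒≅conj (sym {ls} {rs} rs≈ls̄) =
  node≅ (subst (λ zs → SetEq zs (conjs rs)) (conjs-involutive ls) (conjs-SetEq rs≈ls̄)) rs≈ls̄

rightWinsFirst≡leftWinsFirst : ∀ G {X} → conj G ≡ G → Symmetric X →
                               rightWinsFirst (G + X) ≡ leftWinsFirst (G + X)
rightWinsFirst≡leftWinsFirst G {X} G̅≡G X-sym = begin
  rightWinsFirst (G + X)             ≡⟨ leftWinsFirst-conj (G + X) ⟨
  leftWinsFirst (conj (G + X))       ≡⟨ cong leftWinsFirst (conj-distrib-+ G X) ⟩
  leftWinsFirst (conj G + conj X)    ≡⟨ cong (λ K → leftWinsFirst (K + conj X)) G̅≡G ⟩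
  leftWinsFirst (G + conj X)         ≡⟨ cong proj₁ (wins-+-≅ G (symmetric⇒≅conj X-sym)) ⟨
  leftWinsFirst (G + X)              ∎

Any-conjs⁺ : ∀ {P : Game → Set} {xs} → Any (P ∘ conj) xs → Any P (conjs xs)
Any-conjs⁺ {xs = x ∷ xs} (here px) = here px
Any-conjs⁺ {xs = x ∷ xs} (there pxs) = there (Any-conjs⁺ pxs)

Any-conjs⁻ : ∀ {P : Game → Set} xs → Any P (conjs xs) → Any (P ∘ conj) xs
Any-conjs⁻ (x ∷ xs) (here px) = here px
Any-conjs⁻ (x ∷ xs) (there pxs) = there (Any-conjs⁻ xs pxs)

≅∞̄⇒≡∞̄ : ∀ {g} → g ≅ ∞̄ → g ≡ ∞̄
≅∞̄⇒≡∞̄ ∞̄≅ = refl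

∞̄≅conj⇒≡∞ : ∀ g → ∞̄ ≅ conj g → g ≡ ∞
∞̄≅conj⇒≡∞ ∞ ∞̄≅ = refl

∞∈ls⇒∞̄∈rs : ∀ {ls rs} → SetEq rs (conjs ls) → Any (_≡ ∞) ls → Any (_≡ ∞̄) rs
∞∈ls⇒∞̄∈rs (seteq _ ls̄⊆rs) ∞∈ls =
  Any.map ≅∞̄⇒≡∞̄ (All.lookup ls̄⊆rs (Any-conjs⁺ (Any.map (λ { refl → refl }) ∞∈ls)))

∞̄∈rs⇒∞∈ls : ∀ {ls rs} → SetEq rs (conjs ls) → Any (_≡ ∞̄) rs → Any (_≡ ∞) ls
∞̄∈rs⇒∞∈ls {ls} (seteq rs⊆ls̄ _) ∞̄∈rs =
  Any.map (∞̄≅conj⇒≡∞ _) (Any-conjs⁻ ls (All.lookup rs⊆ls̄ (Any.map ≡.sym ∞̄∈rs)))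

_≟∞ : ∀ g → Dec (g ≡ ∞)
∞ ≟∞ = yes refl
∞̄ ≟∞ = no λ ()
node _ _ ≟∞ = no λ ()

carryOnˡ carryOnʳ : Game → Game
carryOnˡ G = node [ ∞ ] [ G ]
carryOnʳ G = node [ G ] [ ∞̄ ]

rightWinsFirst-carryOnˡ : ∀ G {ls rs} → ¬ Any (_≡ ∞̄) rs →
  rightWinsFirst (carryOnˡ G + node ls rs) ≡ not (leftWinsFirst (G + node ls rs))
rightWinsFirst-carryOnˡ G {ls} {rs} ∞̄∉rs =
  ≡.trans (cong (not (leftWinsFirst (G + node ls rs)) ∨_) (losingReplies rs ∞̄∉rs)) (∨-identityʳ _)
  where
  losingReplies : ∀ xs → ¬ Any (_≡ ∞̄) xs → someRightWin (addR (carryOnˡ G) xs) ≡ false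
  losingReplies [] _ = refl
  losingReplies (∞ ∷ xs) ∞̄∉ = losingReplies xs (∞̄∉ ∘ there)
  losingReplies (∞̄ ∷ xs) ∞̄∉ = ⊥-elim (∞̄∉ (here refl))
  losingReplies (node _ _ ∷ xs) ∞̄∉ = losingReplies xs (∞̄∉ ∘ there)

leftWinsFirst-carryOnʳ : ∀ G {ls rs} → ¬ Any (_≡ ∞) ls →
  leftWinsFirst (carryOnʳ G + node ls rs) ≡ not (rightWinsFirst (G + node ls rs))
leftWinsFirst-carryOnʳ G {ls} {rs} ∞∉ls =
  ≡.trans (cong (not (rightWinsFirst (G + node ls rs)) ∨_) (losingReplies ls ∞∉ls)) (∨-identityʳ _)
  where
  losingReplies : ∀ xs → ¬ Any (_≡ ∞) xs → someLeftWin (addR (carryOnʳ G) xs) ≡ false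
  losingReplies [] _ = refl
  losingReplies (∞ ∷ xs) ∞∉ = ⊥-elim (∞∉ (here refl))
  losingReplies (∞̄ ∷ xs) ∞∉ = losingReplies xs (∞∉ ∘ there)
  losingReplies (node _ _ ∷ xs) ∞∉ = losingReplies xs (∞∉ ∘ there)

module _ (n : ℕ) (A : List Game) (*n∈A : Any (_≡ nim n) A) {ls rs} (rs≈ls̄ : SetEq rs (conjs ls)) where

  private
    Sˡ Sʳ : List Game
    Sˡ = carryOnˡ (nim n) ∷ A
    Sʳ = A ++ [ carryOnʳ (nim n) ]

    *n+X-rw≡lw : rightWinsFirst (nim n + node ls rs) ≡ leftWinsFirst (nim n + node ls rs)
    *n+X-rw≡lw = rightWinsFirst≡leftWinsFirst (nim n) (conj-nim n) (sym rs≈ls̄)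

  leftWinsFirst-SMoon+ : leftWinsFirst (SMoon n A + node ls rs) ≡ true
  leftWinsFirst-SMoon+ with any? _≟∞ ls
  ... | yes ∞∈ls = leftWinsFirst-+ʳ {ls = Sˡ} {Sʳ} ∞∈ls refl
  ... | no ∞∉ls = byResult _ refl
    where
    byResult : ∀ b → leftWinsFirst (nim n + node ls rs) ≡ b → leftWinsFirst (SMoon n A + node ls rs) ≡ true
    byResult true *n+X = leftWinsFirst-+ˡ {ls = Sˡ} {Sʳ} (here refl)
      (≡.trans (rightWinsFirst-carryOnˡ (nim n) (∞∉ls ∘ ∞̄∈rs⇒∞∈ls rs≈ls̄)) (cong not *n+X))
    byResult false *n+X = leftWinsFirst-+ˡ {ls = Sˡ} {Sʳ} (there *n∈A) (≡.trans *n+X-rw≡lw *n+X)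

  rightWinsFirst-SMoon+ : rightWinsFirst (SMoon n A + node ls rs) ≡ true
  rightWinsFirst-SMoon+ with any? _≟∞ ls
  ... | yes ∞∈ls = rightWinsFirst-+ʳ {ls = Sˡ} {Sʳ} (∞∈ls⇒∞̄∈rs rs≈ls̄ ∞∈ls) refl
  ... | no ∞∉ls = byResult _ refl
    where
    byResult : ∀ b → rightWinsFirst (nim n + node ls rs) ≡ b → rightWinsFirst (SMoon n A + node ls rs) ≡ true
    byResult true *n+X = rightWinsFirst-+ˡ {ls = Sˡ} {Sʳ} (++⁺ʳ A (here refl))
      (≡.trans (leftWinsFirst-carryOnʳ (nim n) ∞∉ls) (cong not *n+X))
    byResult false *n+X = rightWinsFirst-+ˡ {ls = Sˡ} {Sʳ} (++⁺ˡ *n∈A) (≡.trans (≡.sym *n+X-rw≡lw) *n+X)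

o-SMoon+symmetric : ∀ n A {X} → Any (_≡ nim n) A → Symmetric X → o (SMoon n A + X) ≡ 𝓝
o-SMoon+symmetric n A {X} *n∈A (sym rs≈ls̄) =
  o-𝓝 (SMoon n A + X) (leftWinsFirst-SMoon+ n A *n∈A rs≈ls̄) (rightWinsFirst-SMoon+ n A *n∈A rs≈ls̄)

o-Moon+symmetric : ∀ {X} → Symmetric X → o (Moon + X) ≡ 𝓝
o-Moon+symmetric (sym _) = refl

mainTheorem1 : (n : ℕ) (A : List Game) → All NimOrSMoon A → Any (_≡ nim n) A →
               SMoon n A =Im∞ Moon
mainTheorem1 n A _ *n∈A X (X-sym , _) =
  ≡.trans (o-SMoon+symmetric n A *n∈A X-sym) (≡.sym (o-Moon+symmetric X-sym))
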